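{- For all $k,r\in\mathbb N$, every finite set $V$ and every $\gamma\in\mathcal P(V^k)$: if $\gamma$ is $\mathrm{WL}_{k,r}$-stable then $\gamma$ is $\mathrm C_{k,r}$-stable.
   Context: $[k]=\{1,\dots,k\}$; $[k]^{(r)}$ is the set of $r$-tuples of pairwise distinct elements of $[k]$. A labelled partition of $A$ is a function $\gamma:A\to L$; $\mathcal P(A)$ is the class of these; $\gamma\preceq\rho$ means $\rho(a)=\rho(b)\Rightarrow\gamma(a)=\gamma(b)$, $\gamma\approx\rho$ means both directions. $\vec v\langle\vec i,\vec u\rangle$ is $\vec v\in V^k$ with $u_s$ put in position $i_s$ ($\vec i\in[k]^{(r)}$, $\vec u\in V^r$). For $k\le r$, $\mathrm{WL}_{k,r}\circ\gamma=\mathrm C_{k,r}\circ\gamma=\gamma$; for $r<k$, $\mathrm{WL}_{k,r}\circ\gamma(\vec v)=\big(\gamma(\vec v),\{\{(\gamma(\vec v\langle\vec i,\vec x\rangle))_{\vec i\in[k]^{(r)}}:\vec x\in V^r\}\}\big)$ and $\mathrm C_{k,r}\circ\gamma(\vec v)=\big(\gamma(\vec v),(\{\{\gamma(\vec v\langle\vec i,\vec x\rangle):\vec x\in V^r\}\})_{\vec i\in[k]^{(r)}}\big)$, multisets denoted $\{\{\cdot\}\}$. For an operator $R$, $\gamma$ is $R$-stable if $R\circ\gamma\approx\gamma$. -}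

module Defs where

open import Data.Nat using (ℕ; _<_; _<?_)
open import Data.Fin using (Fin)
open import Data.Vec using (Vec; []; _∷_; lookup; _[_]≔_)
open import Data.Product using (Σ; _×_)
open import Function.Bundles using (_↔_; Inverse)
open import Relation.Binary.PropositionalEquality using (_≡_)
open import Relation.Nullary using (yes; no)

-- A finite set V is represented as Fin n; V^k is Vec (Fin n) k.

Distinct : {k r : ℕ} → Vec (Fin k) r → Set
Distinct {r = r} i = (s t : Fin r) → lookup i s ≡ lookup i t → s ≡ t

insertAt : {A : Set} {k r : ℕ} → Vec A k → Vec (Fin k) r → Vec A r → Vec A k
insertAt v []       []       = v
insertAt v (i ∷ is) (u ∷ us) = insertAt (v [ i ]≔ u) is us

-- Multiset equality of two families indexed by a finite set X:
-- {{f x : x ∈ X}} = {{g x : x ∈ X}}  iff  some bijection σ of X has f ∘ σ = g,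
-- with equality of elements given by the relation R.
MultisetEq : {X A : Set} (R : A → A → Set) → (X → A) → (X → A) → Set
MultisetEq {X} R f g = Σ (X ↔ X) λ σ → (x : X) → R (f (Inverse.to σ x)) (g x)

module _ {n k r : ℕ} {L : Set} (γ : Vec (Fin n) k → L) where

  TupleEq : Vec (Fin n) k → Vec (Fin n) k → Vec (Fin n) r → Vec (Fin n) r → Set
  TupleEq v w x y = (i : Vec (Fin k) r) → Distinct i → γ (insertAt v i x) ≡ γ (insertAt w i y)

  WLEq : Vec (Fin n) k → Vec (Fin n) k → Set
  WLEq v w with r <? k
  ... | yes _ = γ v ≡ γ w × MultisetEq (λ x y → TupleEq v w x y) (λ x → x) (λ x → x)
  ... | no  _ = γ v ≡ γ w

  CEq : Vec (Fin n) k → Vec (Fin n) k → Set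
  CEq v w with r <? k
  ... | yes _ = γ v ≡ γ w × ((i : Vec (Fin k) r) → Distinct i →
                  MultisetEq _≡_ (λ x → γ (insertAt v i x)) (λ x → γ (insertAt w i x)))
  ... | no  _ = γ v ≡ γ w

  -- ρ ≈ γ for ρ given by its kernel relation: ρ(a)=ρ(b) ⇔ γ(a)=γ(b).
  ≈γ : (Vec (Fin n) k → Vec (Fin n) k → Set) → Set
  ≈γ ρEq = (v w : Vec (Fin n) k) → (ρEq v w → γ v ≡ γ w) × (γ v ≡ γ w → ρEq v w)

  WL-stable : Set
  WL-stable = ≈γ WLEq

  C-stable : Set
  C-stable = ≈γ CEq

-- A WL-colour-equivalence of v and w is a single bijection σ of V^r under which the whole
-- tuple of colours (γ(v⟨i,x⟩))ᵢ matches (γ(w⟨i,σx⟩))ᵢ; the same σ witnesses, for each i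
-- separately, the multiset equality required by C. So WL-equivalence refines C-equivalence,
-- and C-equivalence refines γ because γ is one of its components.
module Submission where

open import Defs
open import Data.Nat using (ℕ; _<?_)
open import Data.Fin using (Fin)
open import Data.Vec using (Vec)
open import Data.Product using (_,_; proj₁; proj₂)
open import Relation.Binary.PropositionalEquality using (_≡_)
open import Relation.Nullary using (yes; no)

MultisetEq-map : {X A B : Set} {R : A → A → Set} {S : B → B → Set}
                 {f g : X → A} (h h′ : A → B) →
                 (∀ {a b} → R a b → S (h a) (h′ b)) →
                 MultisetEq R f g → MultisetEq S (λ x → h (f x)) (λ x → h′ (g x))
MultisetEq-map h h′ R⇒S (σ , match) = σ , λ x → R⇒S (match x)

module _ {n k r : ℕ} {L : Set} (γ : Vec (Fin n) k → L) where

  WLEq⇒CEq : ∀ v w → WLEq {n} {k} {r} γ v w → CEq {n} {k} {r} γ v w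
  WLEq⇒CEq v w with r <? k
  ... | yes _ = λ (γv≡γw , tuples) → γv≡γw , λ i distinct →
          MultisetEq-map {R = TupleEq γ v w} {S = _≡_} {f = λ x → x} {g = λ x → x}
                         (λ x → γ (insertAt v i x)) (λ x → γ (insertAt w i x))
                         (λ match → match i distinct) tuples
  ... | no  _ = λ γv≡γw → γv≡γw

  CEq⇒≡ : ∀ v w → CEq {n} {k} {r} γ v w → γ v ≡ γ w
  CEq⇒≡ v w with r <? k
  ... | yes _ = proj₁
  ... | no  _ = λ γv≡γw → γv≡γw

lemma4 : (k r n : ℕ) {L : Set} (γ : Vec (Fin n) k → L) →
    WL-stable {n} {k} {r} γ → C-stable {n} {k} {r} γ
lemma4 k r n γ WL-stable v w =
  CEq⇒≡ γ v w , λ γv≡γw → WLEq⇒CEq γ v w (proj₂ (WL-stable v w) γv≡γw)
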